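{- The variety $\mathbb{CSH}_3$ is term-equivalent to the variety $\mathbb H_3$. More explicitly: (i) if $\mathbf A\in\mathbb{CSH}_3$ then $h(\mathbf A)\in\mathbb H_3$; (ii) if $\mathbf E\in\mathbb H_3$ then $c(\mathbf E)\in\mathbb{CSH}_3$; (iii) for $\mathbf A\in\mathbb{CSH}_3$, $c(h(\mathbf A))=\mathbf A$; (iv) for $\mathbf E\in\mathbb H_3$, $h(c(\mathbf E))=\mathbf E$.
   Context: A semi-Heyting algebra is an algebra $\langle A;\wedge,\vee,\to,0,1\rangle$ such that $\langle A;\wedge,\vee,0,1\rangle$ is a bounded lattice and the identities $x\wedge(x\to y)\approx x\wedge y$, $x\wedge(y\to z)\approx x\wedge((x\wedge y)\to(x\wedge z))$, $x\to x\approx1$ hold; $x^*:=x\to0$. $\mathbb{CSH}_3$ is the variety generated by $\mathbf{CSH3}$, the semi-Heyting algebra on the chain $0<a<1$ with $0\to0=1$, $0\to a=0\to1=0$; $a\to0=0$, $a\to a=a\to1=1$; $1\to0=0$, $1\to a=a$, $1\to1=1$. $\mathbb H_3$ is the variety generated by the 3-element Heyting algebra on the chain $0<a<1$ (where $x\to y=1$ if $x\le y$ and $x\to y=y$ otherwise). For $\mathbf A=\langle A,\vee,\wedge,\to,0,1\rangle\in\mathbb{CSH}_3$, $h(\mathbf A):=\langle A,\vee,\wedge,\to_H,0,1\rangle$ with $x\to_H y:=x\to(x\wedge y)$. For $\mathbf E=\langle E,\vee,\wedge,\to,0,1\rangle\in\mathbb H_3$, $c(\mathbf E):=\langle E,\vee,\wedge,\to_C,0,1\rangle$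 with $x\to_C y:=(x\to y)\wedge(x^*\to y^*)$. -}

module Defs where

open import Data.Nat using (ℕ)
open import Relation.Binary.PropositionalEquality using (_≡_)

record Alg : Set₁ where
  field
    Carrier : Set
    _∧_ _∨_ _⇒_ : Carrier → Carrier → Carrier
    ⊥ₐ ⊤ₐ : Carrier

open Alg public

data Term : Set where
  var  : ℕ → Term
  _∧ₜ_ _∨ₜ_ _⇒ₜ_ : Term → Term → Term
  0ₜ 1ₜ : Term

eval : (A : Alg) → (ℕ → Carrier A) → Term → Carrier A
eval A ρ (var n)  = ρ n
eval A ρ (s ∧ₜ t) = _∧_ A (eval A ρ s) (eval A ρ t)
eval A ρ (s ∨ₜ t) = _∨_ A (eval A ρ s) (eval A ρ t)
eval A ρ (s ⇒ₜ t) = _⇒_ A (eval A ρ s) (eval A ρ t)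
eval A ρ 0ₜ       = ⊥ₐ A
eval A ρ 1ₜ       = ⊤ₐ A

_⊨_≈_ : Alg → Term → Term → Set
A ⊨ s ≈ t = ∀ (ρ : ℕ → Carrier A) → eval A ρ s ≡ eval A ρ t

-- Membership in the variety V(B) generated by B: A satisfies every
-- identity satisfied by B (V(B) = Mod(Id(B)), Birkhoff).
_∈V[_] : Alg → Alg → Set
A ∈V[ B ] = ∀ (s t : Term) → B ⊨ s ≈ t → A ⊨ s ≈ t

data Three : Set where
  z a o : Three

meet3 : Three → Three → Three
meet3 z _ = z
meet3 a z = z
meet3 a _ = a
meet3 o y = y

join3 : Three → Three → Three
join3 z y = y
join3 a o = o
join3 a _ = a
join3 o _ = o

impC : Three → Three → Three
impC z z = o
impC z a = z
impC z o = z
impC a z = z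
impC a a = o
impC a o = o
impC o z = z
impC o a = a
impC o o = o

impH : Three → Three → Three
impH z _ = o
impH a z = z
impH a _ = o
impH o y = y

CSH3 : Alg
CSH3 = record { Carrier = Three ; _∧_ = meet3 ; _∨_ = join3 ; _⇒_ = impC ; ⊥ₐ = z ; ⊤ₐ = o }

H3 : Alg
H3 = record { Carrier = Three ; _∧_ = meet3 ; _∨_ = join3 ; _⇒_ = impH ; ⊥ₐ = z ; ⊤ₐ = o }

h : Alg → Alg
h A = record { Carrier = Carrier A ; _∧_ = _∧_ A ; _∨_ = _∨_ A
             ; _⇒_ = λ x y → _⇒_ A x (_∧_ A x y)
             ; ⊥ₐ = ⊥ₐ A ; ⊤ₐ = ⊤ₐ A }

c : Alg → Alg
c E = record { Carrier = Carrier E ; _∧_ = _∧_ E ; _∨_ = _∨_ E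
             ; _⇒_ = λ x y → _∧_ E (_⇒_ E x y)
                                   (_⇒_ E (_⇒_ E x (⊥ₐ E)) (_⇒_ E y (⊥ₐ E)))
             ; ⊥ₐ = ⊥ₐ E ; ⊤ₐ = ⊤ₐ E }

{-# OPTIONS --safe #-}
-- h and c both replace → by a binary term operation τ(x₀, x₁).  Evaluating a
-- term in such a derived algebra is evaluating its translation (each s → t
-- replaced by τ(s, t)) in the original one, so A ∈ V(B) passes to the derived
-- algebras, and c ∘ h (resp. h ∘ c) is the identity on A as soon as B satisfies
-- the corresponding translated identity.  Everything is thereby reduced to two
-- computations on the three-element chain: h(CSH3) = H3 and c(H3) = CSH3.
module Submission where

open import Defs
open import Data.Nat using (ℕ; zero; suc)
open import Data.Product using (_×_; _,_)
open import Relation.Binary.PropositionalEquality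
  using (_≡_; refl; sym; trans; cong₂; module ≡-Reasoning)

x₀ x₁ : Term
x₀ = var 0
x₁ = var 1

⟨_,_⟩ : {X : Set} → X → X → ℕ → X
⟨ x , y ⟩ zero    = x
⟨ x , y ⟩ (suc _) = y

substitute : (ℕ → Term) → Term → Term
substitute σ (var n)  = σ n
substitute σ (s ∧ₜ t) = substitute σ s ∧ₜ substitute σ t
substitute σ (s ∨ₜ t) = substitute σ s ∨ₜ substitute σ t
substitute σ (s ⇒ₜ t) = substitute σ s ⇒ₜ substitute σ t
substitute σ 0ₜ       = 0ₜ
substitute σ 1ₜ       = 1ₜ

eval-substitute : (A : Alg) {ρ ρ′ : ℕ → Carrier A} (σ : ℕ → Term) →
                  (∀ n → eval A ρ (σ n) ≡ ρ′ n) →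
                  ∀ t → eval A ρ (substitute σ t) ≡ eval A ρ′ t
eval-substitute A σ σ≗ρ′ (var n)  = σ≗ρ′ n
eval-substitute A σ σ≗ρ′ (s ∧ₜ t) =
  cong₂ (_∧_ A) (eval-substitute A σ σ≗ρ′ s) (eval-substitute A σ σ≗ρ′ t)
eval-substitute A σ σ≗ρ′ (s ∨ₜ t) =
  cong₂ (_∨_ A) (eval-substitute A σ σ≗ρ′ s) (eval-substitute A σ σ≗ρ′ t)
eval-substitute A σ σ≗ρ′ (s ⇒ₜ t) =
  cong₂ (_⇒_ A) (eval-substitute A σ σ≗ρ′ s) (eval-substitute A σ σ≗ρ′ t)
eval-substitute A σ σ≗ρ′ 0ₜ       = refl
eval-substitute A σ σ≗ρ′ 1ₜ       = refl

∈V-trans : {A B C : Alg} → A ∈V[ B ] → B ∈V[ C ] → A ∈V[ C ]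
∈V-trans A∈VB B∈VC s t C⊨s≈t = A∈VB s t (B∈VC s t C⊨s≈t)

_[⇒≔_] : (A : Alg) → (Carrier A → Carrier A → Carrier A) → Alg
A [⇒≔ op ] = record A { _⇒_ = op }

eval-[⇒≔] : (A : Alg) {op : Carrier A → Carrier A → Carrier A} →
            (∀ x y → _⇒_ A x y ≡ op x y) →
            ∀ ρ s → eval A ρ s ≡ eval (A [⇒≔ op ]) ρ s
eval-[⇒≔] A ⇒≗op ρ (var n)  = refl
eval-[⇒≔] A ⇒≗op ρ (s ∧ₜ t) =
  cong₂ (_∧_ A) (eval-[⇒≔] A ⇒≗op ρ s) (eval-[⇒≔] A ⇒≗op ρ t)
eval-[⇒≔] A ⇒≗op ρ (s ∨ₜ t) =
  cong₂ (_∨_ A) (eval-[⇒≔] A ⇒≗op ρ s) (eval-[⇒≔] A ⇒≗op ρ t)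
eval-[⇒≔] A {op} ⇒≗op ρ (s ⇒ₜ t) =
  trans (⇒≗op _ _) (cong₂ op (eval-[⇒≔] A ⇒≗op ρ s) (eval-[⇒≔] A ⇒≗op ρ t))
eval-[⇒≔] A ⇒≗op ρ 0ₜ       = refl
eval-[⇒≔] A ⇒≗op ρ 1ₜ       = refl

∈V-[⇒≔] : (A : Alg) {op : Carrier A → Carrier A → Carrier A} →
          (∀ x y → _⇒_ A x y ≡ op x y) → A ∈V[ A [⇒≔ op ] ]
∈V-[⇒≔] A ⇒≗op s t A′⊨s≈t ρ =
  trans (eval-[⇒≔] A ⇒≗op ρ s) (trans (A′⊨s≈t ρ) (sym (eval-[⇒≔] A ⇒≗op ρ t)))

derive : Term → Alg → Alg
derive τ A = A [⇒≔ (λ x y → eval A ⟨ x , y ⟩ τ) ]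

translate : Term → Term → Term
translate τ (var n)  = var n
translate τ (s ∧ₜ t) = translate τ s ∧ₜ translate τ t
translate τ (s ∨ₜ t) = translate τ s ∨ₜ translate τ t
translate τ (s ⇒ₜ t) = substitute ⟨ translate τ s , translate τ t ⟩ τ
translate τ 0ₜ       = 0ₜ
translate τ 1ₜ       = 1ₜ

eval-derive : (τ : Term) (A : Alg) (ρ : ℕ → Carrier A) →
              ∀ s → eval (derive τ A) ρ s ≡ eval A ρ (translate τ s)
eval-derive τ A ρ (var n)  = refl
eval-derive τ A ρ (s ∧ₜ t) = cong₂ (_∧_ A) (eval-derive τ A ρ s) (eval-derive τ A ρ t)
eval-derive τ A ρ (s ∨ₜ t) = cong₂ (_∨_ A) (eval-derive τ A ρ s) (eval-derive τ A ρ t)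
eval-derive τ A ρ (s ⇒ₜ t) =
  sym (eval-substitute A ⟨ translate τ s , translate τ t ⟩ translations τ)
  where
  translations : ∀ n → eval A ρ (⟨ translate τ s , translate τ t ⟩ n)
                     ≡ ⟨ eval (derive τ A) ρ s , eval (derive τ A) ρ t ⟩ n
  translations zero    = sym (eval-derive τ A ρ s)
  translations (suc _) = sym (eval-derive τ A ρ t)
eval-derive τ A ρ 0ₜ       = refl
eval-derive τ A ρ 1ₜ       = refl

⊨-translate : (τ : Term) {A : Alg} (s t : Term) →
              derive τ A ⊨ s ≈ t → A ⊨ translate τ s ≈ translate τ t
⊨-translate τ {A} s t A′⊨s≈t ρ =
  trans (sym (eval-derive τ A ρ s)) (trans (A′⊨s≈t ρ) (eval-derive τ A ρ t))

translate-⊨ : (τ : Term) {A : Alg} (s t : Term) →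
              A ⊨ translate τ s ≈ translate τ t → derive τ A ⊨ s ≈ t
translate-⊨ τ {A} s t A⊨s′≈t′ ρ =
  trans (eval-derive τ A ρ s) (trans (A⊨s′≈t′ ρ) (sym (eval-derive τ A ρ t)))

derive-∈V : (τ : Term) {A B : Alg} → A ∈V[ B ] → derive τ A ∈V[ derive τ B ]
derive-∈V τ A∈VB s t B′⊨s≈t =
  translate-⊨ τ s t (A∈VB (translate τ s) (translate τ t) (⊨-translate τ s t B′⊨s≈t))

derive-inverse : (τ σ : Term) {A B : Alg} → A ∈V[ B ] →
                 B ⊨ translate τ σ ≈ (x₀ ⇒ₜ x₁) →
                 ∀ x y → _⇒_ (derive σ (derive τ A)) x y ≡ _⇒_ A x y
derive-inverse τ σ {A} A∈VB B⊨σ∘τ≈⇒ x y =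
  trans (eval-derive τ A ⟨ x , y ⟩ σ) (A∈VB (translate τ σ) (x₀ ⇒ₜ x₁) B⊨σ∘τ≈⇒ ⟨ x , y ⟩)

-- h A and c A are definitionally derive h-term A and derive c-term A.
h-term c-term : Term
h-term = x₀ ⇒ₜ (x₀ ∧ₜ x₁)
c-term = (x₀ ⇒ₜ x₁) ∧ₜ ((x₀ ⇒ₜ 0ₜ) ⇒ₜ (x₁ ⇒ₜ 0ₜ))

h-CSH3≗H3 : ∀ x y → _⇒_ (h CSH3) x y ≡ impH x y
h-CSH3≗H3 z z = refl
h-CSH3≗H3 z a = refl
h-CSH3≗H3 z o = refl
h-CSH3≗H3 a z = refl
h-CSH3≗H3 a a = refl
h-CSH3≗H3 a o = refl
h-CSH3≗H3 o z = refl
h-CSH3≗H3 o a = refl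
h-CSH3≗H3 o o = refl

c-H3≗CSH3 : ∀ x y → _⇒_ (c H3) x y ≡ impC x y
c-H3≗CSH3 z z = refl
c-H3≗CSH3 z a = refl
c-H3≗CSH3 z o = refl
c-H3≗CSH3 a z = refl
c-H3≗CSH3 a a = refl
c-H3≗CSH3 a o = refl
c-H3≗CSH3 o z = refl
c-H3≗CSH3 o a = refl
c-H3≗CSH3 o o = refl

CSH3⊨c∘h≈⇒ : CSH3 ⊨ translate h-term c-term ≈ (x₀ ⇒ₜ x₁)
CSH3⊨c∘h≈⇒ ρ = begin
  eval CSH3 ρ (translate h-term c-term) ≡⟨ sym (eval-derive h-term CSH3 ρ c-term) ⟩
  eval (h CSH3) ρ c-term                ≡⟨ eval-[⇒≔] (h CSH3) h-CSH3≗H3 ρ c-term ⟩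
  eval H3 ρ c-term                      ≡⟨ c-H3≗CSH3 (ρ 0) (ρ 1) ⟩
  eval CSH3 ρ (x₀ ⇒ₜ x₁)                ∎
  where open ≡-Reasoning

H3⊨h∘c≈⇒ : H3 ⊨ translate c-term h-term ≈ (x₀ ⇒ₜ x₁)
H3⊨h∘c≈⇒ ρ = begin
  eval H3 ρ (translate c-term h-term) ≡⟨ sym (eval-derive c-term H3 ρ h-term) ⟩
  eval (c H3) ρ h-term                ≡⟨ eval-[⇒≔] (c H3) c-H3≗CSH3 ρ h-term ⟩
  eval CSH3 ρ h-term                  ≡⟨ h-CSH3≗H3 (ρ 0) (ρ 1) ⟩
  eval H3 ρ (x₀ ⇒ₜ x₁)                ∎
  where open ≡-Reasoning

corollary6p8 :
    (∀ (A : Alg) → A ∈V[ CSH3 ] → h A ∈V[ H3 ])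
    × (∀ (E : Alg) → E ∈V[ H3 ] → c E ∈V[ CSH3 ])
    × (∀ (A : Alg) → A ∈V[ CSH3 ] → ∀ (x y : Carrier A) → _⇒_ (c (h A)) x y ≡ _⇒_ A x y)
    × (∀ (E : Alg) → E ∈V[ H3 ] → ∀ (x y : Carrier E) → _⇒_ (h (c E)) x y ≡ _⇒_ E x y)
corollary6p8 =
    (λ A A∈V → ∈V-trans (derive-∈V h-term A∈V) (∈V-[⇒≔] (h CSH3) h-CSH3≗H3))
  , (λ E E∈V → ∈V-trans (derive-∈V c-term E∈V) (∈V-[⇒≔] (c H3) c-H3≗CSH3))
  , (λ A A∈V → derive-inverse h-term c-term A∈V CSH3⊨c∘h≈⇒)
  , (λ E E∈V → derive-inverse c-term h-term E∈V H3⊨h∘c≈⇒)
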